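{- Let $T_1$ and $T_2$ be trees. Then $W(T_1\Box T_2)=W(T_1)\times W(T_2)$.
   Context: For a connected graph $H$ and $v\in V(H)$, the weight of $H$ at $v$ is $w_H(v)=\sum_{u\in V(H)}d(u,v)$, where $d$ is the graph distance; a weight center of $H$ is a vertex minimizing $w_H$, and $W(H)$ denotes the set of weight centers. $T_1\Box T_2$ is the Cartesian product, with vertex set $V(T_1)\times V(T_2)$. -}

module Defs where

open import Level using (0ℓ)
open import Data.Nat using (ℕ; zero; suc; _≤_)
open import Data.List using (List; []; _∷_; map; length; cartesianProduct)
open import Data.Nat.ListAction using (sum)
open import Data.List.Membership.Propositional using (_∈_)
open import Data.List.Membership.Propositional.Properties using (∈-cartesianProduct⁺)
open import Data.List.Relation.Unary.Unique.Propositional using (Unique)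
import Data.List.Relation.Unary.Unique.Propositional.Properties as UP
open import Data.Product using (Σ; ∃; _×_; _,_; proj₁; proj₂)
open import Data.Sum using (_⊎_; inj₁; inj₂)
open import Data.Empty using (⊥)
open import Relation.Nullary using (¬_)
open import Relation.Binary.PropositionalEquality using (_≡_; refl; sym)

record Graph : Set₁ where
  field
    V        : Set
    E        : V → V → Set
    E-sym    : ∀ {u v} → E u v → E v u
    E-irrefl : ∀ {v} → ¬ E v v
    verts    : List V
    complete : ∀ v → v ∈ verts
    unique   : Unique verts

open Graph public

data Walk (G : Graph) : V G → V G → ℕ → Set where
  nil  : ∀ {v} → Walk G v v zero
  cons : ∀ {u w v k} → E G u w → Walk G w v k → Walk G u v (suc k)

inner : ∀ {G u v k} → Walk G u v k → List (V G)
inner nil = []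
inner (cons {u = u} _ p) = u ∷ inner p

Connected : Graph → Set
Connected G = ∀ u v → ∃ λ k → Walk G u v k

-- A cycle: a closed walk of length ≥ 3 whose vertices (other than the
-- repeated start/end) are pairwise distinct.
HasCycle : Graph → Set
HasCycle G = Σ (V G) λ v → Σ ℕ λ k →
  Σ (Walk G v v (suc (suc (suc k)))) λ p → Unique (inner p)

IsTree : Graph → Set
IsTree G = Connected G × ¬ HasCycle G

Dist : (G : Graph) → V G → V G → ℕ → Set
Dist G u v k = Walk G u v k × (∀ j → Walk G u v j → k ≤ j)

HasWeight : (G : Graph) → V G → ℕ → Set
HasWeight G v w = Σ (V G → ℕ) λ d →
  (∀ u → Dist G u v (d u)) × (w ≡ sum (map d (verts G)))

IsWeightCenter : (G : Graph) → V G → Set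
IsWeightCenter G v = Σ ℕ λ w → HasWeight G v w ×
  (∀ u w′ → HasWeight G u w′ → w ≤ w′)

_□_ : Graph → Graph → Graph
G □ H = record
  { V        = V G × V H
  ; E        = λ { (a , b) (c , d) → (E G a c × b ≡ d) ⊎ (a ≡ c × E H b d) }
  ; E-sym    = λ { (inj₁ (e , q)) → inj₁ (E-sym G e , sym q)
                 ; (inj₂ (q , e)) → inj₂ (sym q , E-sym H e) }
  ; E-irrefl = λ { (inj₁ (e , _)) → E-irrefl G e
                 ; (inj₂ (_ , e)) → E-irrefl H e }
  ; verts    = cartesianProduct (verts G) (verts H)
  ; complete = λ { (a , b) → ∈-cartesianProduct⁺ (complete G a) (complete H b) }
  ; unique   = UP.cartesianProduct⁺ (unique G) (unique H)
  }

-- A walk in G □ H projects to walks in G and H whose lengths add up to its own, and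
-- conversely walks in the factors can be run one after the other, so
-- d((a,b),(c,d)) = d(a,c) + d(b,d). Summing over all vertices gives
-- w(u₁,u₂) = |H|·w(u₁) + |G|·w(u₂), and a sum of this form with positive coefficients
-- is minimal exactly when both summands are. Nothing here uses that the factors are trees.
module Submission where

open import Defs
open import Data.Nat using (ℕ; suc; _+_; _*_; _≤_; NonZero; >-nonZero)
open import Data.Nat.Properties
open import Algebra.Properties.CommutativeSemigroup +-commutativeSemigroup
  using () renaming (interchange to +-interchange)
open import Data.Nat.ListAction using (sum)
open import Data.Nat.ListAction.Properties using (sum-++)
open import Data.List using (List; []; _∷_; _++_; map; length; cartesianProduct)
open import Data.List.Properties using (map-++; map-∘; map-cong)
open import Data.List.Membership.Propositional.Properties using (∈-length)
open import Data.Product using (∃₂; _×_; _,_; proj₁; proj₂)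
open import Data.Sum using (inj₁; inj₂)
open import Function using (_∘_)
open import Function.Bundles using (_⇔_; mk⇔)
open import Relation.Binary.PropositionalEquality

order : Graph → ℕ
order G = length (verts G)

order-nonZero : ∀ {G} → V G → NonZero (order G)
order-nonZero {G} v = >-nonZero (∈-length (complete G v))

module _ {A : Set} where

  sum-map-+ : ∀ (f g : A → ℕ) xs →
    sum (map (λ x → f x + g x) xs) ≡ sum (map f xs) + sum (map g xs)
  sum-map-+ f g []       = refl
  sum-map-+ f g (x ∷ xs) =
    trans (cong (f x + g x +_) (sum-map-+ f g xs)) (+-interchange (f x) (g x) _ _)

  sum-map-const : ∀ c (xs : List A) → sum (map (λ _ → c) xs) ≡ length xs * c
  sum-map-const c []       = refl
  sum-map-const c (x ∷ xs) = cong (c +_) (sum-map-const c xs)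

module _ {A B : Set} where

  sum-map-proj₁-cartesianProduct : ∀ (f : A → ℕ) xs (ys : List B) →
    sum (map (f ∘ proj₁) (cartesianProduct xs ys)) ≡ length ys * sum (map f xs)
  sum-map-proj₁-cartesianProduct f []       ys = sym (*-zeroʳ (length ys))
  sum-map-proj₁-cartesianProduct f (x ∷ xs) ys = begin
    sum (map (f ∘ proj₁) (map (x ,_) ys ++ cartesianProduct xs ys))
      ≡⟨ cong sum (map-++ (f ∘ proj₁) (map (x ,_) ys) _) ⟩
    sum (map (f ∘ proj₁) (map (x ,_) ys) ++ map (f ∘ proj₁) (cartesianProduct xs ys))
      ≡⟨ sum-++ (map (f ∘ proj₁) (map (x ,_) ys)) _ ⟩
    sum (map (f ∘ proj₁) (map (x ,_) ys)) + sum (map (f ∘ proj₁) (cartesianProduct xs ys))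
      ≡⟨ cong₂ _+_ (trans (cong sum (sym (map-∘ ys))) (sum-map-const (f x) ys))
                   (sum-map-proj₁-cartesianProduct f xs ys) ⟩
    length ys * f x + length ys * sum (map f xs)
      ≡⟨ *-distribˡ-+ (length ys) (f x) _ ⟨
    length ys * sum (map f (x ∷ xs))
      ∎
    where open ≡-Reasoning

  sum-map-proj₂-cartesianProduct : ∀ (g : B → ℕ) (xs : List A) ys →
    sum (map (g ∘ proj₂) (cartesianProduct xs ys)) ≡ length xs * sum (map g ys)
  sum-map-proj₂-cartesianProduct g []       ys = refl
  sum-map-proj₂-cartesianProduct g (x ∷ xs) ys = begin
    sum (map (g ∘ proj₂) (map (x ,_) ys ++ cartesianProduct xs ys))
      ≡⟨ cong sum (map-++ (g ∘ proj₂) (map (x ,_) ys) _) ⟩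
    sum (map (g ∘ proj₂) (map (x ,_) ys) ++ map (g ∘ proj₂) (cartesianProduct xs ys))
      ≡⟨ sum-++ (map (g ∘ proj₂) (map (x ,_) ys)) _ ⟩
    sum (map (g ∘ proj₂) (map (x ,_) ys)) + sum (map (g ∘ proj₂) (cartesianProduct xs ys))
      ≡⟨ cong₂ _+_ (cong sum (sym (map-∘ ys))) (sum-map-proj₂-cartesianProduct g xs ys) ⟩
    sum (map g ys) + length xs * sum (map g ys)
      ∎
    where open ≡-Reasoning

  sum-map-cartesianProduct : ∀ (f : A → ℕ) (g : B → ℕ) xs ys →
    sum (map (λ p → f (proj₁ p) + g (proj₂ p)) (cartesianProduct xs ys))
      ≡ length ys * sum (map f xs) + length xs * sum (map g ys)
  sum-map-cartesianProduct f g xs ys =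
    trans (sum-map-+ (f ∘ proj₁) (g ∘ proj₂) (cartesianProduct xs ys))
          (cong₂ _+_ (sum-map-proj₁-cartesianProduct f xs ys)
                     (sum-map-proj₂-cartesianProduct g xs ys))

_++ʷ_ : ∀ {G x y z k j} → Walk G x y k → Walk G y z j → Walk G x z (k + j)
nil      ++ʷ q = q
cons e p ++ʷ q = cons e (p ++ʷ q)

Dist-unique : ∀ {G x y k k′} → Dist G x y k → Dist G x y k′ → k ≡ k′
Dist-unique (p , min) (p′ , min′) = ≤-antisym (min _ p′) (min′ _ p)

module _ {G H : Graph} where

  liftˡ : ∀ {a c k} b → Walk G a c k → Walk (G □ H) (a , b) (c , b) k
  liftˡ b nil        = nil
  liftˡ b (cons e p) = cons (inj₁ (e , refl)) (liftˡ b p)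

  liftʳ : ∀ {b d k} a → Walk H b d k → Walk (G □ H) (a , b) (a , d) k
  liftʳ a nil        = nil
  liftʳ a (cons e p) = cons (inj₂ (refl , e)) (liftʳ a p)

  record Projections (x y : V (G □ H)) (k : ℕ) : Set where
    constructor projections
    field
      {k₁ k₂}    : ℕ
      walk₁      : Walk G (proj₁ x) (proj₁ y) k₁
      walk₂      : Walk H (proj₂ x) (proj₂ y) k₂
      length-sum : k₁ + k₂ ≡ k

  project : ∀ {x y k} → Walk (G □ H) x y k → Projections x y k
  project nil = projections nil nil refl
  project (cons (inj₁ (e , refl)) p) with projections p₁ p₂ eq ← project p =
    projections (cons e p₁) p₂ (cong suc eq)
  project (cons (inj₂ (refl , e)) p) with projections {k₁} {k₂} p₁ p₂ eq ← project p =
    projections p₁ (cons e p₂) (trans (+-suc k₁ k₂) (cong suc eq))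

  Dist-□ : ∀ {a b c d k₁ k₂} → Dist G a c k₁ → Dist H b d k₂ →
    Dist (G □ H) (a , b) (c , d) (k₁ + k₂)
  Dist-□ {a} {b} {c} {d} {k₁} {k₂} (p₁ , min₁) (p₂ , min₂) =
    liftˡ b p₁ ++ʷ liftʳ c p₂ , shortest
    where
    shortest : ∀ j → Walk (G □ H) (a , b) (c , d) j → k₁ + k₂ ≤ j
    shortest j p with projections q₁ q₂ refl ← project p =
      +-mono-≤ (min₁ _ q₁) (min₂ _ q₂)

  Dist-□⁻¹ˡ : ∀ {a c b k} → Dist (G □ H) (a , b) (c , b) k → Dist G a c k
  Dist-□⁻¹ˡ {b = b} (p , min) with projections {k₁} {k₂} p₁ _ refl ← project p =
    subst (Walk G _ _) k₁≡k₁+k₂ p₁ , λ j q → min j (liftˡ b q)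
    where
    k₁≡k₁+k₂ : k₁ ≡ k₁ + k₂
    k₁≡k₁+k₂ = ≤-antisym (m≤m+n k₁ k₂) (min k₁ (liftˡ b p₁))

  Dist-□⁻¹ʳ : ∀ {b d a k} → Dist (G □ H) (a , b) (a , d) k → Dist H b d k
  Dist-□⁻¹ʳ {a = a} (p , min) with projections {k₁} {k₂} _ p₂ refl ← project p =
    subst (Walk H _ _) k₂≡k₁+k₂ p₂ , λ j q → min j (liftʳ a q)
    where
    k₂≡k₁+k₂ : k₂ ≡ k₁ + k₂
    k₂≡k₁+k₂ = ≤-antisym (m≤n+m k₂ k₁) (min k₂ (liftʳ a p₂))

  HasWeight-□ : ∀ {u₁ u₂ w₁ w₂} → HasWeight G u₁ w₁ → HasWeight H u₂ w₂ →
    HasWeight (G □ H) (u₁ , u₂) (order H * w₁ + order G * w₂)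
  HasWeight-□ (d₁ , dist₁ , refl) (d₂ , dist₂ , refl) =
    (λ p → d₁ (proj₁ p) + d₂ (proj₂ p)) ,
    (λ p → Dist-□ (dist₁ (proj₁ p)) (dist₂ (proj₂ p))) ,
    sym (sum-map-cartesianProduct d₁ d₂ (verts G) (verts H))

  -- The distances to (u₁, u₂) along the two fibres through it are factor distances,
  -- and by Dist-□ they determine all the others.
  HasWeight-□⁻¹ : ∀ {u₁ u₂ w} → HasWeight (G □ H) (u₁ , u₂) w →
    ∃₂ λ w₁ w₂ → HasWeight G u₁ w₁ × HasWeight H u₂ w₂ × w ≡ order H * w₁ + order G * w₂
  HasWeight-□⁻¹ {u₁} {u₂} (d , dist , refl) =
    _ , _ , (d₁ , dist₁ , refl) , (d₂ , dist₂ , refl) , (begin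
      sum (map d (verts (G □ H)))
        ≡⟨ cong sum (map-cong d-split (verts (G □ H))) ⟩
      sum (map (λ p → d₁ (proj₁ p) + d₂ (proj₂ p)) (verts (G □ H)))
        ≡⟨ sum-map-cartesianProduct d₁ d₂ (verts G) (verts H) ⟩
      order H * sum (map d₁ (verts G)) + order G * sum (map d₂ (verts H))
        ∎)
    where
    open ≡-Reasoning
    d₁ : V G → ℕ
    d₁ a = d (a , u₂)
    d₂ : V H → ℕ
    d₂ b = d (u₁ , b)
    dist₁ : ∀ a → Dist G a u₁ (d₁ a)
    dist₁ a = Dist-□⁻¹ˡ (dist (a , u₂))
    dist₂ : ∀ b → Dist H b u₂ (d₂ b)
    dist₂ b = Dist-□⁻¹ʳ (dist (u₁ , b))
    d-split : ∀ p → d p ≡ d₁ (proj₁ p) + d₂ (proj₂ p)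
    d-split (a , b) = Dist-unique (dist (a , b)) (Dist-□ (dist₁ a) (dist₂ b))

  weightCenter-□⁺ : ∀ {v₁ v₂} → IsWeightCenter G v₁ → IsWeightCenter H v₂ →
    IsWeightCenter (G □ H) (v₁ , v₂)
  weightCenter-□⁺ (w₁ , h₁ , min₁) (w₂ , h₂ , min₂) =
    _ , HasWeight-□ h₁ h₂ , minimal
    where
    minimal : ∀ u w → HasWeight (G □ H) u w → order H * w₁ + order G * w₂ ≤ w
    minimal (u₁ , u₂) w hw with w₁′ , w₂′ , h₁′ , h₂′ , refl ← HasWeight-□⁻¹ hw =
        +-mono-≤ (*-monoʳ-≤ (order H) (min₁ u₁ w₁′ h₁′))
                 (*-monoʳ-≤ (order G) (min₂ u₂ w₂′ h₂′))

  weightCenter-□⁻ : ∀ {v₁ v₂} → IsWeightCenter (G □ H) (v₁ , v₂) →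
    IsWeightCenter G v₁ × IsWeightCenter H v₂
  weightCenter-□⁻ {v₁} {v₂} (w , hw , min) with HasWeight-□⁻¹ hw
  ... | w₁ , w₂ , h₁ , h₂ , refl =
    (w₁ , h₁ , λ u₁ w₁′ h₁′ → *-cancelˡ-≤ (order H) {{order-nonZero {H} v₂}}
      (+-cancelʳ-≤ (order G * w₂) _ _ (min (u₁ , v₂) _ (HasWeight-□ h₁′ h₂)))) ,
    (w₂ , h₂ , λ u₂ w₂′ h₂′ → *-cancelˡ-≤ (order G) {{order-nonZero {G} v₁}}
      (+-cancelˡ-≤ (order H * w₁) _ _ (min (v₁ , u₂) _ (HasWeight-□ h₁ h₂′))))

weightCenter-□ : ∀ (G H : Graph) v₁ v₂ →
  IsWeightCenter (G □ H) (v₁ , v₂) ⇔ (IsWeightCenter G v₁ × IsWeightCenter H v₂)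
weightCenter-□ G H v₁ v₂ = mk⇔ weightCenter-□⁻ (λ (c₁ , c₂) → weightCenter-□⁺ c₁ c₂)

lemma2p4 : (T₁ T₂ : Graph) → IsTree T₁ → IsTree T₂ →
    ∀ (v₁ : V T₁) (v₂ : V T₂) →
    IsWeightCenter (T₁ □ T₂) (v₁ , v₂) ⇔ (IsWeightCenter T₁ v₁ × IsWeightCenter T₂ v₂)
lemma2p4 T₁ T₂ _ _ = weightCenter-□ T₁ T₂
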